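{- Let $b\ge 2$, $m\ge1$ be integers, $\Sigma$ an alphabet with $m$ letters, $\sigma$ a cyclic permutation of $\Sigma$ (a single $m$-cycle), $\overline{\alpha}\in\Sigma$, and suppose the corresponding generalized Thue–Morse word $\mathbf{t}$ is aperiodic. If $w$ is a factor of $\mathbf{t}$ of length $\ell\ge b$ with $b\nmid\ell$, then $\textsc{Index}(w)\le 2$.
   Context: $\mu(\alpha)=\alpha\,\sigma(\alpha)\cdots\sigma^{b-1}(\alpha)$, $\mathbf{t}=\lim_n\mu^n(\overline{\alpha})$. Aperiodic means not ultimately periodic. For a nonempty word $w$ and rational $r>0$ with $r|w|\in\mathbb N$, $w^r=w^{\lfloor r\rfloor}p$ with $p$ the prefix of $w$ of length $(r-\lfloor r\rfloor)|w|$; $\textsc{Index}(w)=\max\{r\in\mathbb Q: w^r\text{ is a factor of }\mathbf{t}\}$ (or $\infty$ if no maximum exists). -}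

module Defs where

open import Data.Nat using (ℕ; zero; suc; _+_; _*_; _≤_; _<_)
open import Data.Fin using (Fin)
open import Data.Fin.Permutation using (Permutation′; _⟨$⟩ʳ_)
open import Data.List using (List; []; _∷_; map; concatMap; upTo; take; concat; replicate; length)
open import Data.Product using (Σ; ∃; _×_; _,_)
open import Relation.Binary.PropositionalEquality using (_≡_)
open import Relation.Nullary using (¬_)

iter : ∀ {A : Set} → (A → A) → ℕ → A → A
iter f zero    x = x
iter f (suc k) x = f (iter f k x)

-- σ is a cyclic permutation of Fin m (a single m-cycle):
-- every letter is reachable from every other letter by iterating σ
IsCyclic : ∀ {m} → Permutation′ m → Set
IsCyclic {m} σ = ∀ (x y : Fin m) → ∃ λ k → iter (σ ⟨$⟩ʳ_) k x ≡ y

μ : ∀ {m} → ℕ → Permutation′ m → Fin m → List (Fin m)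
μ b σ a = map (λ k → iter (σ ⟨$⟩ʳ_) k a) (upTo b)

μPow : ∀ {m} → ℕ → Permutation′ m → Fin m → ℕ → List (Fin m)
μPow b σ a n = iter (concatMap (μ b σ)) n (a ∷ [])

nth : ∀ {A : Set} → A → List A → ℕ → A
nth d []       _       = d
nth d (x ∷ xs) zero    = x
nth d (x ∷ xs) (suc i) = nth d xs i

-- t = lim μ^n(ᾱ): the i-th letter of t is the i-th letter of μ^{i+1}(ᾱ),
-- which has length b^{i+1} > i when b ≥ 2 (and μ^n(ᾱ) is a prefix of μ^{n+1}(ᾱ))
tm : ∀ {m} → ℕ → Permutation′ m → Fin m → ℕ → Fin m
tm b σ a i = nth a (μPow b σ a (suc i)) i

UltPeriodic : ∀ {A : Set} → (ℕ → A) → Set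
UltPeriodic t = Σ ℕ λ p → Σ ℕ λ N → (0 < p) × (∀ i → N ≤ i → t (i + p) ≡ t i)

Aperiodic : ∀ {A : Set} → (ℕ → A) → Set
Aperiodic t = ¬ UltPeriodic t

factorAt : ∀ {A : Set} → (ℕ → A) → ℕ → ℕ → List A
factorAt t i n = map (λ j → t (i + j)) (upTo n)

IsFactor : ∀ {A : Set} → (ℕ → A) → List A → Set
IsFactor t w = ∃ λ i → factorAt t i (length w) ≡ w

-- w^r where L = r|w| ∈ ℕ: the prefix of length L of w w w ⋯,
-- i.e. w^{⌊r⌋} followed by the prefix of w of length (r - ⌊r⌋)|w|
fracPow : ∀ {A : Set} → List A → ℕ → List A
fracPow w L = take L (concat (replicate (suc L) w))

-- Index(w) ≤ 2 : every rational r > 0 with r|w| ∈ ℕ and w^r a factor of t has r ≤ 2,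
-- i.e. every L = r|w| with w^{L/|w|} a factor satisfies L ≤ 2|w|
IndexAtMost2 : ∀ {A : Set} → (ℕ → A) → List A → Set
IndexAtMost2 t w = ∀ (L : ℕ) → 0 < L → IsFactor t (fracPow w L) → L ≤ 2 * length w

-- Write s for σ as a function. The Thue–Morse word satisfies t(bk + j) = s^j (t k) for
-- j < b, so t(n + 1) = s(t n) unless b ∣ n + 1. Suppose t contains w^L with |w| = ℓ and L > 2ℓ,
-- so t has period ℓ on a window of length 2ℓ + 1. Since b ≤ ℓ, the window contains a position
-- n = bK + b - 1 with b ∤ K + 1. As b ∣ n + 1 but b ∤ ℓ, shifting by ±ℓ gives a position q with
-- b ∤ q + 1 and t q = t n, t(q + 1) = t(n + 1). Comparing
--   t(n + 1) = t(K + 1) = s(t K)   with   t(q + 1) = s(t q) = s(t n) = s^b (t K)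
-- shows that s^{b-1} has a fixed point; σ being a single cycle, s^{b-1} is the identity.
-- But then t(n + 1) = s(t n) for every n, so t has period b - 1, contradicting aperiodicity.
module Submission where

open import Defs
open import Data.Nat using (ℕ; zero; suc; _+_; _*_; _∸_; _^_; _≤_; _<_; z≤n; s≤s; _≤?_; _<?_; >-nonZero)
open import Data.Nat.Properties
open import Data.Nat.Divisibility using (_∣_; _∣?_; ∣m+n∣m⇒∣n; ∣1⇒≡1; m∣m*n)
open import Data.Nat.DivMod using (_/_; _%_; m≡m%n+[m/n]*n; m%n<n)
open import Data.Nat.Induction using (<-rec)
open import Data.Nat.Tactic.RingSolver using (solve-∀)
open import Data.Fin using (Fin)
open import Data.Fin.Permutation using (Permutation′; _⟨$⟩ʳ_)
open import Data.List using (List; []; _∷_; _++_; length; map; concat; concatMap; replicate; take; applyUpTo; upTo)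
open import Data.List.Properties using (length-++; length-map; length-applyUpTo; length-take; ++-assoc; ++-identityʳ; concatMap-++)
open import Data.Product using (∃; ∃₂; _×_; _,_; proj₂)
open import Data.Sum using (inj₁; inj₂)
open import Data.Empty using (⊥-elim)
open import Relation.Nullary using (¬_; yes; no)
open import Relation.Binary.PropositionalEquality using (_≡_; refl; sym; trans; cong; subst; module ≡-Reasoning)

nth-++ˡ : ∀ {A : Set} (d : A) xs ys {i} → i < length xs → nth d (xs ++ ys) i ≡ nth d xs i
nth-++ˡ d (x ∷ xs) ys {zero}  _         = refl
nth-++ˡ d (x ∷ xs) ys {suc i} (s≤s i<) = nth-++ˡ d xs ys i<

nth-++ʳ : ∀ {A : Set} (d : A) xs ys i → nth d (xs ++ ys) (length xs + i) ≡ nth d ys i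
nth-++ʳ d []       ys i = refl
nth-++ʳ d (x ∷ xs) ys i = nth-++ʳ d xs ys i

nth-take : ∀ {A : Set} (d : A) n xs {i} → i < n → nth d (take n xs) i ≡ nth d xs i
nth-take d (suc n) []       _                 = refl
nth-take d (suc n) (x ∷ xs) {zero}  _         = refl
nth-take d (suc n) (x ∷ xs) {suc i} (s≤s i<) = nth-take d n xs i<

nth-map-applyUpTo : ∀ {A B : Set} (d : B) (f : A → B) (g : ℕ → A) n {j} → j < n →
                    nth d (map f (applyUpTo g n)) j ≡ f (g j)
nth-map-applyUpTo d f g (suc n) {zero}  _         = refl
nth-map-applyUpTo d f g (suc n) {suc j} (s≤s j<) = nth-map-applyUpTo d f (λ k → g (suc k)) n j<

iter-commute : ∀ {A : Set} (f : A → A) n x → iter f n (f x) ≡ f (iter f n x)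
iter-commute f zero    x = refl
iter-commute f (suc n) x = cong f (iter-commute f n x)

iter-+ : ∀ {A : Set} (f : A → A) j k x → iter f (j + k) x ≡ iter f j (iter f k x)
iter-+ f zero    k x = refl
iter-+ f (suc j) k x = cong f (iter-+ f j k x)

iter-fixed-orbit : ∀ {A : Set} (f : A → A) k {x} → iter f k x ≡ x → ∀ j → iter f k (iter f j x) ≡ iter f j x
iter-fixed-orbit f k {x} fx j = begin
  iter f k (iter f j x)  ≡⟨ iter-+ f k j x ⟨
  iter f (k + j) x       ≡⟨ cong (λ i → iter f i x) (+-comm k j) ⟩
  iter f (j + k) x       ≡⟨ iter-+ f j k x ⟩
  iter f j (iter f k x)  ≡⟨ cong (iter f j) fx ⟩
  iter f j x             ∎
  where open ≡-Reasoning

cyclic-fixed-everywhere : ∀ {m} (σ : Permutation′ m) → IsCyclic σ → ∀ k {x} →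
                          iter (σ ⟨$⟩ʳ_) k x ≡ x → ∀ y → iter (σ ⟨$⟩ʳ_) k y ≡ y
cyclic-fixed-everywhere σ cyc k {x} fx y with cyc x y
... | j , refl = iter-fixed-orbit (σ ⟨$⟩ʳ_) k fx j

step-+ : ∀ {A : Set} (f : A → A) (t : ℕ → A) → (∀ n → t (suc n) ≡ f (t n)) →
         ∀ i k → t (i + k) ≡ iter f k (t i)
step-+ f t step i zero    = cong t (+-identityʳ i)
step-+ f t step i (suc k) = trans (cong t (+-suc i k)) (trans (step (i + k)) (cong f (step-+ f t step i k)))

ultPeriodic-of-step : ∀ {A : Set} (f : A → A) (t : ℕ → A) k → (∀ n → t (suc n) ≡ f (t n)) →
                      (∀ x → iter f (suc k) x ≡ x) → UltPeriodic t
ultPeriodic-of-step f t k step fix = suc k , 0 , s≤s z≤n , λ i _ → trans (step-+ f t step i (suc k)) (fix (t i))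

concat-replicate-suc : ∀ {A : Set} n (w : List A) → concat (replicate (suc n) w) ≡ concat (replicate n w) ++ w
concat-replicate-suc zero    w = ++-identityʳ w
concat-replicate-suc (suc n) w = trans (cong (w ++_) (concat-replicate-suc n w)) (sym (++-assoc w _ w))

length-concat-replicate : ∀ {A : Set} n (w : List A) → length (concat (replicate n w)) ≡ n * length w
length-concat-replicate zero    w = refl
length-concat-replicate (suc n) w = trans (length-++ w) (cong (length w +_) (length-concat-replicate n w))

nth-concat-replicate-periodic : ∀ {A : Set} (d : A) n (w : List A) i → i + length w < length (concat (replicate n w)) →
                                nth d (concat (replicate n w)) (i + length w) ≡ nth d (concat (replicate n w)) i
nth-concat-replicate-periodic d zero    w i ()
nth-concat-replicate-periodic d (suc n) w i lt = begin
  nth d (w ++ W) (i + ℓ)  ≡⟨ cong (nth d (w ++ W)) (+-comm i ℓ) ⟩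
  nth d (w ++ W) (ℓ + i)  ≡⟨ nth-++ʳ d w W i ⟩
  nth d W i               ≡⟨ nth-++ˡ d W w i<W ⟨
  nth d (W ++ w) i        ≡⟨ cong (λ xs → nth d xs i) (concat-replicate-suc n w) ⟨
  nth d (w ++ W) i        ∎
  where
  open ≡-Reasoning
  ℓ = length w
  W = concat (replicate n w)
  i<W : i < length W
  i<W = +-cancelˡ-< ℓ i (length W) (subst (_< ℓ + length W) (+-comm i ℓ) (subst (i + ℓ <_) (length-++ w) lt))

n≤length-concat-replicate : ∀ {A : Set} n (w : List A) → 0 < length w → n ≤ length (concat (replicate (suc n) w))
n≤length-concat-replicate n w ℓ>0 = subst (n ≤_) (sym (length-concat-replicate (suc n) w))
  (≤-trans (n≤1+n n) (m≤m*n (suc n) (length w) {{>-nonZero ℓ>0}}))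

length-fracPow : ∀ {A : Set} (w : List A) L → 0 < length w → length (fracPow w L) ≡ L
length-fracPow w L ℓ>0 = trans (length-take L _) (m≤n⇒m⊓n≡m (n≤length-concat-replicate L w ℓ>0))

nth-fracPow-periodic : ∀ {A : Set} (d : A) (w : List A) L i → 0 < length w → i + length w < L →
                       nth d (fracPow w L) (i + length w) ≡ nth d (fracPow w L) i
nth-fracPow-periodic d w L i ℓ>0 lt = begin
  nth d (take L W) (i + ℓ)  ≡⟨ nth-take d L W lt ⟩
  nth d W (i + ℓ)           ≡⟨ nth-concat-replicate-periodic d (suc L) w i (<-≤-trans lt (n≤length-concat-replicate L w ℓ>0)) ⟩
  nth d W i                 ≡⟨ nth-take d L W (≤-<-trans (m≤m+n i ℓ) lt) ⟨
  nth d (take L W) i        ∎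
  where
  open ≡-Reasoning
  ℓ = length w
  W = concat (replicate (suc L) w)

nth-factorAt : ∀ {A : Set} (d : A) (t : ℕ → A) p n {i} → i < n → nth d (factorAt t p n) i ≡ t (p + i)
nth-factorAt d t p n = nth-map-applyUpTo d (λ j → t (p + j)) (λ j → j) n

PeriodicOn : ∀ {A : Set} → (ℕ → A) → ℕ → ℕ → ℕ → Set
PeriodicOn t ℓ p e = ∀ n → p ≤ n → n + ℓ < e → t (n + ℓ) ≡ t n

factor-fracPow-periodicOn : ∀ {A : Set} (t : ℕ → A) (w : List A) L p → 0 < length w →
                            factorAt t p (length (fracPow w L)) ≡ fracPow w L → PeriodicOn t (length w) p (p + L)
factor-fracPow-periodicOn t w L p ℓ>0 factor n p≤n lt = begin
  t (n + ℓ)            ≡⟨ cong (λ k → t (k + ℓ)) p+i≡n ⟨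
  t (p + i + ℓ)        ≡⟨ cong t (+-assoc p i ℓ) ⟩
  t (p + (i + ℓ))      ≡⟨ letter (i + ℓ) i+ℓ<L ⟨
  nth d fp (i + ℓ)     ≡⟨ nth-fracPow-periodic d w L i ℓ>0 i+ℓ<L ⟩
  nth d fp i           ≡⟨ letter i (≤-<-trans (m≤m+n i ℓ) i+ℓ<L) ⟩
  t (p + i)            ≡⟨ cong t p+i≡n ⟩
  t n                  ∎
  where
  open ≡-Reasoning
  ℓ = length w
  d = t p
  fp = fracPow w L
  i = n ∸ p
  p+i≡n : p + i ≡ n
  p+i≡n = m+[n∸m]≡n p≤n
  i+ℓ<L : i + ℓ < L
  i+ℓ<L = +-cancelˡ-< p (i + ℓ) L (subst (_< p + L) (trans (cong (_+ ℓ) (sym p+i≡n)) (+-assoc p i ℓ)) lt)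
  letter : ∀ j → j < L → nth d fp j ≡ t (p + j)
  letter j j<L = trans (cong (λ xs → nth d xs j) (sym factor))
                       (nth-factorAt d t p (length fp) (subst (j <_) (sym (length-fracPow w L ℓ>0)) j<L))

-- Shifting by ±ℓ inside a window with period ℓ: since d ∤ ℓ, the shifted position escapes d ∣ _ + 1.
periodicOn-partner : ∀ {A : Set} {t : ℕ → A} {ℓ p e d n} → PeriodicOn t ℓ p e → p + (ℓ + ℓ) < e → ¬ d ∣ ℓ →
                     p ≤ n → n < p + (ℓ + ℓ) → d ∣ suc n →
                     ∃ λ q → ¬ d ∣ suc q × t (suc q) ≡ t (suc n) × t q ≡ t n
periodicOn-partner {t = t} {ℓ} {p} {e} {d} {n} per big d∤ℓ p≤n n<p+2ℓ d∣ with n <? p + ℓ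
... | yes n<p+ℓ = n + ℓ , (λ d∣′ → d∤ℓ (∣m+n∣m⇒∣n d∣′ d∣))
                , per (suc n) (≤-trans p≤n (n≤1+n n)) bound
                , per n p≤n (<-trans (n<1+n _) bound)
  where
  bound : suc n + ℓ < e
  bound = ≤-<-trans (subst (suc n + ℓ ≤_) (+-assoc p ℓ ℓ) (+-monoˡ-≤ ℓ n<p+ℓ)) big
... | no n≮p+ℓ = subst (λ k → ∃ λ q → ¬ d ∣ suc q × t (suc q) ≡ t (suc k) × t q ≡ t k) q+ℓ≡n backward
  where
  q = n ∸ ℓ
  q+ℓ≡n : q + ℓ ≡ n
  q+ℓ≡n = m∸n+n≡m (≤-trans (m≤n+m ℓ p) (≮⇒≥ n≮p+ℓ))
  p≤q : p ≤ q
  p≤q = +-cancelʳ-≤ ℓ p q (subst (p + ℓ ≤_) (sym q+ℓ≡n) (≮⇒≥ n≮p+ℓ))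
  q+ℓ<p+2ℓ : q + ℓ < p + (ℓ + ℓ)
  q+ℓ<p+2ℓ = subst (_< p + (ℓ + ℓ)) (sym q+ℓ≡n) n<p+2ℓ
  backward : ∃ λ q′ → ¬ d ∣ suc q′ × t (suc q′) ≡ t (suc (q + ℓ)) × t q′ ≡ t (q + ℓ)
  backward = q , (λ d∣′ → d∤ℓ (∣m+n∣m⇒∣n (subst (λ k → d ∣ suc k) (sym q+ℓ≡n) d∣) d∣′))
               , sym (per (suc q) (≤-trans p≤q (n≤1+n q)) (≤-<-trans q+ℓ<p+2ℓ big))
               , sym (per q p≤q (<-trans q+ℓ<p+2ℓ big))

-- b is written c + 2, so that b - 1 = suc c.
module ThueMorse (c : ℕ) {m : ℕ} (σ : Permutation′ m) (a : Fin m) where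
  b : ℕ
  b = suc (suc c)

  s : Fin m → Fin m
  s = σ ⟨$⟩ʳ_

  T : ℕ → Fin m
  T = tm b σ a

  μPowᵃ : ℕ → List (Fin m)
  μPowᵃ = μPow b σ a

  length-μ : ∀ x → length (μ b σ x) ≡ b
  length-μ x = trans (length-map _ (upTo b)) (length-applyUpTo (λ k → k) b)

  length-concatMap-μ : ∀ xs → length (concatMap (μ b σ) xs) ≡ b * length xs
  length-concatMap-μ []       = sym (*-zeroʳ b)
  length-concatMap-μ (x ∷ xs) = trans (length-++ (μ b σ x))
    (trans (cong (_+ length (concatMap (μ b σ) xs)) (length-μ x))
      (trans (cong (b +_) (length-concatMap-μ xs)) (sym (*-suc b (length xs)))))

  length-μPow : ∀ n → length (μPowᵃ n) ≡ b ^ n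
  length-μPow zero    = refl
  length-μPow (suc n) = trans (length-concatMap-μ (μPowᵃ n)) (cong (b *_) (length-μPow n))

  μPow-suc-prefix : ∀ n → ∃ λ zs → μPowᵃ (suc n) ≡ μPowᵃ n ++ zs
  μPow-suc-prefix zero    = _ , refl
  μPow-suc-prefix (suc n) with μPow-suc-prefix n
  ... | zs , eq = concatMap (μ b σ) zs , trans (cong (concatMap (μ b σ)) eq) (concatMap-++ (μ b σ) (μPowᵃ n) zs)

  μPow-+-prefix : ∀ k n → ∃ λ zs → μPowᵃ (k + n) ≡ μPowᵃ n ++ zs
  μPow-+-prefix zero    n = [] , sym (++-identityʳ _)
  μPow-+-prefix (suc k) n with μPow-+-prefix k n | μPow-suc-prefix (k + n)
  ... | zs , eq | zs′ , eq′ = zs ++ zs′ , trans eq′ (trans (cong (_++ zs′) eq) (++-assoc (μPowᵃ n) zs zs′))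

  nth-μPow-+ : ∀ k n {i} → i < b ^ n → nth a (μPowᵃ (k + n)) i ≡ nth a (μPowᵃ n) i
  nth-μPow-+ k n i< with μPow-+-prefix k n
  ... | zs , eq = trans (cong (λ xs → nth a xs _) eq) (nth-++ˡ a (μPowᵃ n) zs (subst (_ <_) (sym (length-μPow n)) i<))

  n<b^[1+n] : ∀ n → n < b ^ suc n
  n<b^[1+n] zero    = s≤s z≤n
  n<b^[1+n] (suc n) = ≤-<-trans (n<b^[1+n] n) (^-monoʳ-< b (s≤s (s≤s z≤n)) (n<1+n (suc n)))

  nth-μPow : ∀ n {i} → i < b ^ n → nth a (μPowᵃ n) i ≡ T i
  nth-μPow n {i} i< = begin
    nth a (μPowᵃ n) i            ≡⟨ nth-μPow-+ (suc i) n i< ⟨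
    nth a (μPowᵃ (suc i + n)) i  ≡⟨ cong (λ k → nth a (μPowᵃ k) i) (+-comm (suc i) n) ⟩
    nth a (μPowᵃ (n + suc i)) i  ≡⟨ nth-μPow-+ n (suc i) (n<b^[1+n] i) ⟩
    T i                          ∎
    where open ≡-Reasoning

  nth-concatMap-μ : ∀ xs k {j} → k < length xs → j < b →
                    nth a (concatMap (μ b σ) xs) (b * k + j) ≡ iter s j (nth a xs k)
  nth-concatMap-μ (x ∷ xs) zero {j} _ j<b = begin
    nth a (μ b σ x ++ F) (b * 0 + j)  ≡⟨ cong (λ i → nth a (μ b σ x ++ F) (i + j)) (*-zeroʳ b) ⟩
    nth a (μ b σ x ++ F) j            ≡⟨ nth-++ˡ a (μ b σ x) F (subst (j <_) (sym (length-μ x)) j<b) ⟩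
    nth a (μ b σ x) j                 ≡⟨ nth-map-applyUpTo a (λ k → iter s k x) (λ k → k) b j<b ⟩
    iter s j x                        ∎
    where
    open ≡-Reasoning
    F = concatMap (μ b σ) xs
  nth-concatMap-μ (x ∷ xs) (suc k) {j} (s≤s k<) j<b = begin
    nth a (μ b σ x ++ F) (b * suc k + j)               ≡⟨ cong (nth a (μ b σ x ++ F)) shift ⟩
    nth a (μ b σ x ++ F) (length (μ b σ x) + (b * k + j)) ≡⟨ nth-++ʳ a (μ b σ x) F _ ⟩
    nth a F (b * k + j)                               ≡⟨ nth-concatMap-μ xs k k< j<b ⟩
    iter s j (nth a xs k)                             ∎
    where
    open ≡-Reasoning
    F = concatMap (μ b σ) xs
    shift : b * suc k + j ≡ length (μ b σ x) + (b * k + j)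
    shift = trans (cong (_+ j) (*-suc b k))
      (trans (+-assoc b (b * k) j) (cong (_+ (b * k + j)) (sym (length-μ x))))

  digit-position<b^[2+k] : ∀ k {j} → j < b → b * k + j < b ^ (2 + k)
  digit-position<b^[2+k] k {j} j<b = begin-strict
    b * k + j    <⟨ +-monoʳ-< (b * k) j<b ⟩
    b * k + b    ≡⟨ trans (+-comm (b * k) b) (sym (*-suc b k)) ⟩
    b * suc k    ≤⟨ *-monoʳ-≤ b (n<b^[1+n] k) ⟩
    b ^ (2 + k)  ∎
    where open ≤-Reasoning

  tm-digit : ∀ k {j} → j < b → T (b * k + j) ≡ iter s j (T k)
  tm-digit k {j} j<b = begin
    T (b * k + j)                                          ≡⟨ nth-μPow (2 + k) (digit-position<b^[2+k] k j<b) ⟨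
    nth a (concatMap (μ b σ) (μPowᵃ (suc k))) (b * k + j)  ≡⟨ nth-concatMap-μ (μPowᵃ (suc k)) k k<length j<b ⟩
    iter s j (T k)                                         ∎
    where
    open ≡-Reasoning
    k<length : k < length (μPowᵃ (suc k))
    k<length = subst (k <_) (sym (length-μPow (suc k))) (n<b^[1+n] k)

  last-digit : ∀ n → ∃₂ λ q r → r ≤ suc c × n ≡ b * q + r
  last-digit n = n / b , n % b , ≤-pred (m%n<n n b)
               , trans (m≡m%n+[m/n]*n n b) (trans (+-comm (n % b) _) (cong (_+ n % b) (*-comm (n / b) b)))

  suc-last-digit : ∀ q → suc (b * q + suc c) ≡ b * suc q
  suc-last-digit q = trans (sym (+-suc (b * q) (suc c))) (trans (+-comm (b * q) b) (sym (*-suc b q)))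

  tm-carry : ∀ q → T (suc (b * q + suc c)) ≡ T (suc q)
  tm-carry q = trans (cong T (trans (suc-last-digit q) (sym (+-identityʳ _)))) (tm-digit (suc q) (s≤s z≤n))

  tm-suc-noCarry : ∀ q {r} → r < suc c → T (suc (b * q + r)) ≡ s (T (b * q + r))
  tm-suc-noCarry q {r} r<1+c = begin
    T (suc (b * q + r))    ≡⟨ cong T (+-suc (b * q) r) ⟨
    T (b * q + suc r)      ≡⟨ tm-digit q (s≤s r<1+c) ⟩
    s (iter s r (T q))     ≡⟨ cong s (tm-digit q (<-trans r<1+c (n<1+n (suc c)))) ⟨
    s (T (b * q + r))      ∎
    where open ≡-Reasoning

  tm-suc : ∀ n → ¬ b ∣ suc n → T (suc n) ≡ s (T n)
  tm-suc n b∤ with last-digit n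
  ... | q , r , r≤1+c , n≡ rewrite n≡ with m≤n⇒m<n∨m≡n r≤1+c
  ...   | inj₁ r<1+c = tm-suc-noCarry q r<1+c
  ...   | inj₂ refl  = ⊥-elim (b∤ (subst (b ∣_) (sym (suc-last-digit q)) (m∣m*n (suc q))))

  tm-suc-of-fixed : (∀ x → iter s (suc c) x ≡ x) → ∀ n → T (suc n) ≡ s (T n)
  tm-suc-of-fixed fix = <-rec _ step
    where
    step : ∀ n → (∀ {k} → k < n → T (suc k) ≡ s (T k)) → T (suc n) ≡ s (T n)
    step n ih with last-digit n
    ... | q , r , r≤1+c , n≡ rewrite n≡ with m≤n⇒m<n∨m≡n r≤1+c
    ...   | inj₁ r<1+c = tm-suc-noCarry q r<1+c
    ...   | inj₂ refl  = begin
      T (suc (b * q + suc c))  ≡⟨ tm-carry q ⟩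
      T (suc q)                ≡⟨ ih q<n ⟩
      s (T q)                  ≡⟨ cong s (fix (T q)) ⟨
      s (iter s (suc c) (T q)) ≡⟨ cong s (tm-digit q (n<1+n (suc c))) ⟨
      s (T (b * q + suc c))    ∎
      where
      open ≡-Reasoning
      q<n : q < b * q + suc c
      q<n = ≤-<-trans (m≤n*m q b) (m<m+n (b * q) (s≤s z≤n))

  tm-periodic : (∀ x → iter s (suc c) x ≡ x) → UltPeriodic T
  tm-periodic fix = ultPeriodic-of-step s T c (tm-suc-of-fixed fix) fix

  fixedPoint-of-collision : ∀ K q → ¬ b ∣ suc K → ¬ b ∣ suc q →
                            T (suc q) ≡ T (suc (b * K + suc c)) → T q ≡ T (b * K + suc c) →
                            iter s (suc c) (T (suc K)) ≡ T (suc K)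
  fixedPoint-of-collision K q b∤K b∤q suc-match match = begin
    iter s (suc c) (T (suc K))    ≡⟨ cong (iter s (suc c)) (tm-suc K b∤K) ⟩
    iter s (suc c) (s (T K))      ≡⟨ iter-commute s (suc c) (T K) ⟩
    s (iter s (suc c) (T K))      ≡⟨ cong s (tm-digit K (n<1+n (suc c))) ⟨
    s (T (b * K + suc c))         ≡⟨ cong s match ⟨
    s (T q)                       ≡⟨ tm-suc q b∤q ⟨
    T (suc q)                     ≡⟨ suc-match ⟩
    T (suc (b * K + suc c))       ≡⟨ tm-carry K ⟩
    T (suc K)                     ∎
    where open ≡-Reasoning

  last-block-bounds : ∀ {p q r ℓ} K → r ≤ suc c → p ≡ b * q + r → b ≤ ℓ → q ≤ K → K ≤ suc q →
                      p ≤ b * K + suc c × b * K + suc c < p + (ℓ + ℓ)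
  last-block-bounds {p} {q} {r} {ℓ} K r≤1+c p≡ b≤ℓ q≤K K≤1+q = lower , upper
    where
    open ≤-Reasoning
    lower : p ≤ b * K + suc c
    lower = begin
      p              ≡⟨ p≡ ⟩
      b * q + r      ≤⟨ +-mono-≤ (*-monoʳ-≤ b q≤K) r≤1+c ⟩
      b * K + suc c  ∎
    upper : b * K + suc c < p + (ℓ + ℓ)
    upper = begin-strict
      b * K + suc c      ≤⟨ +-monoˡ-≤ (suc c) (*-monoʳ-≤ b K≤1+q) ⟩
      b * suc q + suc c  <⟨ +-monoʳ-< (b * suc q) (n<1+n (suc c)) ⟩
      b * suc q + b      ≡⟨ regroup b q ⟩
      b * q + (b + b)    ≤⟨ +-mono-≤ (subst (b * q ≤_) (sym p≡) (m≤m+n (b * q) r)) (+-mono-≤ b≤ℓ b≤ℓ) ⟩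
      p + (ℓ + ℓ)        ∎
      where
      regroup : ∀ x y → x * suc y + x ≡ x * y + (x + x)
      regroup = solve-∀

  -- Of the blocks K, K + 1 following p, at least one has b ∤ K + 1, as b ≥ 2.
  last-block-in-window : ∀ p {ℓ} → b ≤ ℓ → ∃ λ K → ¬ b ∣ suc K × p ≤ b * K + suc c × b * K + suc c < p + (ℓ + ℓ)
  last-block-in-window p b≤ℓ with last-digit p
  ... | q , r , r≤1+c , p≡ with b ∣? suc q
  ...   | no b∤1+q  = q , b∤1+q , last-block-bounds q r≤1+c p≡ b≤ℓ ≤-refl (n≤1+n q)
  ...   | yes b∣1+q = suc q , b∤2+q , last-block-bounds (suc q) r≤1+c p≡ b≤ℓ (n≤1+n q) ≤-refl
    where
    b∤2+q : ¬ b ∣ suc (suc q)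
    b∤2+q b∣2+q with ∣1⇒≡1 (∣m+n∣m⇒∣n (subst (b ∣_) (+-comm 1 (suc q)) b∣2+q) b∣1+q)
    ... | ()

  fixedPoint-of-square : ∀ {ℓ p e} → b ≤ ℓ → ¬ b ∣ ℓ → PeriodicOn T ℓ p e → p + (ℓ + ℓ) < e →
                         ∃ λ x → iter s (suc c) x ≡ x
  fixedPoint-of-square {p = p} b≤ℓ b∤ℓ per window with last-block-in-window p b≤ℓ
  ... | K , b∤1+K , p≤n , n<p+2ℓ with periodicOn-partner per window b∤ℓ p≤n n<p+2ℓ b∣1+n
    where
    b∣1+n : b ∣ suc (b * K + suc c)
    b∣1+n = subst (b ∣_) (sym (suc-last-digit K)) (m∣m*n (suc K))
  ... | q , b∤1+q , suc-match , match = T (suc K) , fixedPoint-of-collision K q b∤1+K b∤1+q suc-match match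

  ultPeriodic-of-square : IsCyclic σ → ∀ {ℓ p e} → b ≤ ℓ → ¬ b ∣ ℓ → PeriodicOn T ℓ p e → p + (ℓ + ℓ) < e →
                          UltPeriodic T
  ultPeriodic-of-square cyc b≤ℓ b∤ℓ per window =
    tm-periodic (cyclic-fixed-everywhere σ cyc (suc c) (proj₂ (fixedPoint-of-square b≤ℓ b∤ℓ per window)))

lemma3p4 : (b m : ℕ) → 2 ≤ b → 1 ≤ m → (σ : Permutation′ m) → IsCyclic σ → (ᾱ : Fin m) →
    Aperiodic (tm b σ ᾱ) →
    (w : List (Fin m)) → IsFactor (tm b σ ᾱ) w → b ≤ length w → ¬ (b ∣ length w) →
    IndexAtMost2 (tm b σ ᾱ) w
lemma3p4 (suc (suc c)) m (s≤s (s≤s z≤n)) _ σ cyc ᾱ aperiodic w _ b≤ℓ b∤ℓ L _ (p , factor)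
  with L ≤? 2 * length w
... | yes L≤2ℓ = L≤2ℓ
... | no L≰2ℓ = ⊥-elim (aperiodic (ultPeriodic-of-square cyc b≤ℓ b∤ℓ periodic window))
  where
  open ThueMorse c σ ᾱ
  ℓ = length w
  periodic : PeriodicOn T ℓ p (p + L)
  periodic = factor-fracPow-periodicOn T w L p (≤-trans (s≤s z≤n) b≤ℓ) factor
  window : p + (ℓ + ℓ) < p + L
  window = +-monoʳ-< p (subst (_< L) (cong (ℓ +_) (+-identityʳ ℓ)) (≰⇒> L≰2ℓ))
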